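{- Let $G$ be a graph and $k$ a positive integer. There is a sequence of at most $k$ graph modifications that transforms $G$ into a cluster graph if and only if $G$ admits a cover of cost at most $k$.
   Context: Graphs are finite, simple, undirected. A \emph{cluster graph} is a graph in which every connected component is a clique. A \emph{graph modification} is a vertex split, an edge addition, or an edge deletion; a \emph{vertex split} of $u$ replaces $u$ by two new vertices $v,w$, keeping all edges not incident to $u$ and distributing the edges incident to $u$ among $v$ and $w$ so that the union of the new neighborhoods of $v,w$ equals $N_G(u)$. A \emph{cover} of $G$ is a collection $\mathcal{C}$ of subsets of $V(G)$ with $\bigcup_{C\in\mathcal{C}}C=V(G)$; its \emph{cost} is $\mathrm{cst}_G(\mathcal{C}) = |\{uv\in\binom{V(G)}{2}\setminus E(G) : \exists C\in\mathcal{C},\ \{u,v\}\subseteq C\}| + |\{uv\in E(G) : \forall C\in\mathcal{C},\ \{u,v\}\not\subseteq C\}| + \sum_{C\in\mathcal{C}}|C| - |V(G)|$, where $\binom{V}{2}$ is the set of 2-element subsets of $V$. -}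

module Defs where

open import Data.Nat using (ℕ; zero; suc; _+_; _∸_; _≤_)
open import Data.Bool using (Bool; true; false; _∧_; _∨_; not; if_then_else_)
open import Data.Fin using (Fin; inject₁; fromℕ)
open import Data.Fin.Properties using (_≟_; _<?_)
open import Data.Fin.Subset using (Subset; ∣_∣)
open import Data.Vec using (lookup)
open import Data.List using (List; map)
open import Data.Bool.ListAction using (any)
open import Data.Nat.ListAction using (sum)
open import Data.List.Relation.Unary.Any using (Any)
open import Data.List.Relation.Unary.Unique.Propositional using (Unique)
open import Data.Product using (Σ; _×_; ∃)
open import Relation.Nullary using (¬_)
open import Relation.Nullary.Decidable using (⌊_⌋)
open import Relation.Binary.PropositionalEquality using (_≡_; _≢_)

record Graph (n : ℕ) : Set where
  field
    adj    : Fin n → Fin n → Bool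
    sym    : ∀ u v → adj u v ≡ adj v u
    irrefl : ∀ u → adj u u ≡ false
open Graph public

data Connected {n} (G : Graph n) : Fin n → Fin n → Set where
  here : ∀ {u} → Connected G u u
  step : ∀ {u v w} → adj G u v ≡ true → Connected G v w → Connected G u w

IsCluster : ∀ {n} → Graph n → Set
IsCluster {n} G = ∀ (u v : Fin n) → u ≢ v → Connected G u v → adj G u v ≡ true

isPair : ∀ {n} → Fin n → Fin n → Fin n → Fin n → Bool
isPair u v x y = (⌊ x ≟ u ⌋ ∧ ⌊ y ≟ v ⌋) ∨ (⌊ x ≟ v ⌋ ∧ ⌊ y ≟ u ⌋)

-- Vertex split of u: in H (on Fin (suc n)) the vertex inject₁ u plays the role
-- of v and the new last vertex fromℕ n plays the role of w; all other
-- vertices x of G are identified with inject₁ x.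
data Modification {n : ℕ} (G : Graph n) : {m : ℕ} → Graph m → Set where
  edgeAddition : (u v : Fin n) → u ≢ v → adj G u v ≡ false → (H : Graph n) →
    (∀ x y → adj H x y ≡ (adj G x y ∨ isPair u v x y)) →
    Modification G H
  edgeDeletion : (u v : Fin n) → adj G u v ≡ true → (H : Graph n) →
    (∀ x y → adj H x y ≡ (adj G x y ∧ not (isPair u v x y))) →
    Modification G H
  vertexSplit : (u : Fin n) → (H : Graph (suc n)) →
    (∀ x y → x ≢ u → y ≢ u → adj H (inject₁ x) (inject₁ y) ≡ adj G x y) →
    adj H (inject₁ u) (fromℕ n) ≡ false →
    (∀ x → x ≢ u → adj G u x ≡ (adj H (inject₁ u) (inject₁ x) ∨ adj H (fromℕ n) (inject₁ x))) →
    Modification G H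

data Modifications {n : ℕ} (G : Graph n) : {m : ℕ} → Graph m → ℕ → Set where
  done : Modifications G G 0
  more : ∀ {m l j} {H : Graph m} {K : Graph l} →
    Modification G H → Modifications H K j → Modifications G K (suc j)

sumFin : ∀ {n} → (Fin n → ℕ) → ℕ
sumFin {zero}  f = 0
sumFin {suc n} f = f Fin.zero + sumFin (λ i → f (Fin.suc i))
  where import Data.Fin as Fin

countPairs : ∀ {n} → (Fin n → Fin n → Bool) → ℕ
countPairs p = sumFin (λ x → sumFin (λ y → if ⌊ x <? y ⌋ ∧ p x y then 1 else 0))

IsCover : ∀ n → List (Subset n) → Set
IsCover n Cs = Unique Cs × (∀ (x : Fin n) → Any (λ C → lookup C x ≡ true) Cs)

togetherIn : ∀ {n} → List (Subset n) → Fin n → Fin n → Bool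
togetherIn Cs x y = any (λ C → lookup C x ∧ lookup C y) Cs

cost : ∀ {n} → Graph n → List (Subset n) → ℕ
cost {n} G Cs =
  (countPairs (λ x y → not (adj G x y) ∧ togetherIn Cs x y)
   + countPairs (λ x y → adj G x y ∧ not (togetherIn Cs x y))
   + sum (map ∣_∣ Cs)) ∸ n

{-# OPTIONS --safe #-}
module Submission where

-- Write P(G, 𝒞) for the number of vertex pairs on which adjacency in G disagrees with lying together
-- in a member of 𝒞, and S(𝒞) for the sum of the sizes of the members; the cost is P + S − n, and
-- S ≥ n for a cover. Along a sequence of modifications ending in a cluster graph, covers are pulled
-- back from the end: the closed neighbourhoods of a cluster graph give P = 0 and S = n, an edge
-- addition or deletion changes P by at most one, and undoing a vertex split by merging its two
-- halves in every member increases neither P nor S while n drops by one. Conversely, a cover with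
-- P + S ≤ k + n is realised greedily: toggle a pair on which G and the cover disagree (P drops by
-- one), or else split a vertex lying in two members between the first of them and the rest (S − n
-- drops by one); when neither applies, G agrees with a cover in which every vertex lies in exactly
-- one member, so G is a cluster graph.

open import Defs hiding (sym)

open import Data.Bool using (Bool; true; false; _∧_; _∨_; not; _xor_; if_then_else_)
import Data.Bool.Properties as Bool
open import Data.Bool.Properties
  using (∧-comm; ∧-zeroʳ; ∧-identityʳ; ∧-distribʳ-∨; ∨-assoc; ∨-comm; ∨-zeroʳ; ∨-identityʳ; xor-same)
open import Data.Bool.ListAction using (any)
open import Data.Empty using (⊥-elim)
open import Data.Fin using (Fin; inject₁; fromℕ; toℕ) renaming (zero to fzero; suc to fsuc)
open import Data.Fin.Properties
  using (_≟_; _<?_; <⇒≢; any?; suc-injective; inject₁-injective; fromℕ≢inject₁;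
         toℕ-injective; toℕ-inject₁; toℕ-fromℕ; toℕ<n)
open import Data.Fin.Subset using (Subset; ∣_∣)
open import Data.List using (List; []; _∷_; map; _++_; deduplicate; filter; allFin)
open import Data.List.Properties using (map-++)
open import Data.List.Membership.Propositional using (_∈_)
open import Data.List.Membership.Propositional.Properties using (∈-allFin; ∈-map⁻; ∈-deduplicate⁻)
open import Data.List.Relation.Unary.All using (All; []; _∷_)
import Data.List.Relation.Unary.All as All
open import Data.List.Relation.Unary.AllPairs using ([]; _∷_)
open import Data.List.Relation.Unary.Any using (Any; here; there; satisfied) renaming (map to mapAny)
import Data.List.Relation.Unary.Any.Properties as Anyₚ
open import Data.List.Relation.Unary.Unique.Propositional using (Unique)
open import Data.List.Relation.Unary.Unique.DecPropositional.Properties using (deduplicate-!)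
open import Data.Nat using (ℕ; zero; suc; _+_; _∸_; _≤_; _<_; z≤n; s≤s; _≤?_)
open import Data.Nat.ListAction using (sum)
open import Data.Nat.ListAction.Properties using (sum-++)
open import Data.Nat.Properties
  using (+-comm; +-assoc; +-suc; +-identityʳ; +-mono-≤; +-monoˡ-≤; +-monoʳ-≤; +-cancelʳ-≤;
         ≤-refl; ≤-trans; ≤-reflexive; ≤-pred; ≤-antisym; <-irrefl; <-asym; ≮⇒≥; ≰⇒>; n≤0⇒n≡0;
         m≤m+n; m≤n+m; m≤n+m∸n; ∸-monoˡ-≤; m+n∸n≡m; +-commutativeSemigroup; module ≤-Reasoning)
open import Algebra.Properties.CommutativeSemigroup +-commutativeSemigroup using (interchange; xy∙z≈zy∙x)
open import Data.Product using (Σ; _×_; _,_; proj₁; proj₂; ∃)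
open import Data.Sum using (_⊎_; inj₁; inj₂)
open import Data.Vec using (Vec; []; _∷_; lookup; tabulate; updateAt; _[_]≔_; _∷ʳ_; init; last; initLast)
open import Data.Vec.Properties
  using (≡-dec; lookup∘tabulate; tabulate-cong; lookup∘updateAt; lookup∘updateAt′; lookup∘update′)
open import Function using (_∘_)
open import Function.Bundles using (_⇔_; mk⇔; Equivalence)
open import Relation.Binary.PropositionalEquality
open import Relation.Nullary using (¬_; Dec)
open import Relation.Nullary.Decidable using (⌊_⌋; yes; no; does; ¬?; _×-dec_)
open import Relation.Unary using (Pred; Decidable)

𝟙 : Bool → ℕ
𝟙 b = if b then 1 else 0

bool-ext : ∀ {a b} → (a ≡ true → b ≡ true) → (b ≡ true → a ≡ true) → a ≡ b
bool-ext {true}          a⇒b b⇒a = sym (a⇒b refl)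
bool-ext {false} {true}  a⇒b b⇒a = b⇒a refl
bool-ext {false} {false} a⇒b b⇒a = refl

∧-true : ∀ a b → a ∧ b ≡ true → a ≡ true × b ≡ true
∧-true true true _ = refl , refl

≟-refl : ∀ {n} (x : Fin n) → ⌊ x ≟ x ⌋ ≡ true
≟-refl x with x ≟ x
... | yes _   = refl
... | no x≢x = ⊥-elim (x≢x refl)

≟-≢ : ∀ {n} {x y : Fin n} → x ≢ y → ⌊ x ≟ y ⌋ ≡ false
≟-≢ {x = x} {y} x≢y with x ≟ y
... | yes x≡y = ⊥-elim (x≢y x≡y)
... | no _    = refl

≟-sym : ∀ {n} (x y : Fin n) → ⌊ x ≟ y ⌋ ≡ ⌊ y ≟ x ⌋
≟-sym x y with x ≟ y
... | yes refl = sym (≟-refl x)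
... | no x≢y   = sym (≟-≢ (x≢y ∘ sym))

sumFin-cong : ∀ {n} {f g : Fin n → ℕ} → (∀ x → f x ≡ g x) → sumFin f ≡ sumFin g
sumFin-cong {zero}  f≗g = refl
sumFin-cong {suc n} f≗g = cong₂ _+_ (f≗g fzero) (sumFin-cong (f≗g ∘ fsuc))

sumFin-mono : ∀ {n} {f g : Fin n → ℕ} → (∀ x → f x ≤ g x) → sumFin f ≤ sumFin g
sumFin-mono {zero}  f≤g = z≤n
sumFin-mono {suc n} f≤g = +-mono-≤ (f≤g fzero) (sumFin-mono (f≤g ∘ fsuc))

sumFin-+ : ∀ {n} (f g : Fin n → ℕ) → sumFin (λ x → f x + g x) ≡ sumFin f + sumFin g
sumFin-+ {zero}  f g = refl
sumFin-+ {suc n} f g =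
  trans (cong (f fzero + g fzero +_) (sumFin-+ (f ∘ fsuc) (g ∘ fsuc)))
        (interchange (f fzero) (g fzero) _ _)

sumFin-zero : ∀ {n} (f : Fin n → ℕ) → (∀ x → f x ≡ 0) → sumFin f ≡ 0
sumFin-zero {zero}  f f≗0 = refl
sumFin-zero {suc n} f f≗0 = cong₂ _+_ (f≗0 fzero) (sumFin-zero (f ∘ fsuc) (f≗0 ∘ fsuc))

sumFin-one : ∀ n → sumFin {n} (λ _ → 1) ≡ n
sumFin-one zero    = refl
sumFin-one (suc n) = cong suc (sumFin-one n)

sumFin-inject₁ : ∀ {n} (f : Fin (suc n) → ℕ) → sumFin f ≡ sumFin (f ∘ inject₁) + f (fromℕ n)
sumFin-inject₁ {zero}  f = +-comm (f fzero) 0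
sumFin-inject₁ {suc n} f =
  trans (cong (f fzero +_) (sumFin-inject₁ (f ∘ fsuc))) (sym (+-assoc (f fzero) _ _))

sumFin-concentrated : ∀ {n} (f : Fin n → ℕ) (u : Fin n) →
  (∀ x → x ≢ u → f x ≡ 0) → sumFin f ≡ f u
sumFin-concentrated {suc n} f fzero f≗0 =
  trans (cong (f fzero +_) (sumFin-zero (f ∘ fsuc) (λ x → f≗0 (fsuc x) λ ()))) (+-identityʳ _)
sumFin-concentrated {suc n} f (fsuc u) f≗0 =
  trans (cong (_+ sumFin (f ∘ fsuc)) (f≗0 fzero λ ()))
        (sumFin-concentrated (f ∘ fsuc) u (λ x x≢u → f≗0 (fsuc x) (x≢u ∘ suc-injective)))

sumFin-mono-< : ∀ {n} {f g : Fin n → ℕ} (u : Fin n) →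
  (∀ x → f x ≤ g x) → f u < g u → sumFin f < sumFin g
sumFin-mono-< {suc n} fzero f≤g fu<gu = +-mono-≤ fu<gu (sumFin-mono (f≤g ∘ fsuc))
sumFin-mono-< {suc n} {f} {g} (fsuc u) f≤g fu<gu =
  subst (_≤ sumFin g) (+-suc (f fzero) _) (+-mono-≤ (f≤g fzero) (sumFin-mono-< u (f≤g ∘ fsuc) fu<gu))

onlyAt : ∀ {n} → Fin n → ℕ → Fin n → ℕ
onlyAt u k x = if ⌊ x ≟ u ⌋ then k else 0

onlyAt-self : ∀ {n} (u : Fin n) k → onlyAt u k u ≡ k
onlyAt-self u k = cong (λ b → if b then k else 0) (≟-refl u)

onlyAt-other : ∀ {n} {u x : Fin n} k → x ≢ u → onlyAt u k x ≡ 0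
onlyAt-other k x≢u = cong (λ b → if b then k else 0) (≟-≢ x≢u)

sumFin-onlyAt : ∀ {n} (u : Fin n) (g : Fin n → ℕ) → sumFin (λ x → onlyAt u (g x) x) ≡ g u
sumFin-onlyAt u g =
  trans (sumFin-concentrated _ u (λ x → onlyAt-other (g x))) (onlyAt-self u (g u))

sumAbove : ∀ {n} → (Fin n → Fin n → ℕ) → Fin n → ℕ
sumAbove h x = sumFin λ y → if ⌊ x <? y ⌋ then h x y else 0

sumPairs : ∀ {n} → (Fin n → Fin n → ℕ) → ℕ
sumPairs h = sumFin (sumAbove h)

countPairs≡sumPairs : ∀ {n} (p : Fin n → Fin n → Bool) → countPairs p ≡ sumPairs (λ x y → 𝟙 (p x y))
countPairs≡sumPairs p = sumFin-cong λ x → sumFin-cong λ y → if-∧ ⌊ x <? y ⌋ (p x y)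
  where
  if-∧ : ∀ a b → (if a ∧ b then 1 else 0) ≡ (if a then 𝟙 b else 0)
  if-∧ true  b = refl
  if-∧ false b = refl

sumPairs-cong : ∀ {n} {h k : Fin n → Fin n → ℕ} →
  (∀ x y → x ≢ y → h x y ≡ k x y) → sumPairs h ≡ sumPairs k
sumPairs-cong {h = h} {k} h≗k = sumFin-cong λ x → sumFin-cong λ y → guarded x y
  where
  guarded : ∀ x y → (if ⌊ x <? y ⌋ then h x y else 0) ≡ (if ⌊ x <? y ⌋ then k x y else 0)
  guarded x y with x <? y
  ... | yes x<y = h≗k x y (<⇒≢ x<y)
  ... | no _    = refl

sumPairs-mono : ∀ {n} {h k : Fin n → Fin n → ℕ} →
  (∀ x y → x ≢ y → h x y ≤ k x y) → sumPairs h ≤ sumPairs k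
sumPairs-mono {h = h} {k} h≤k = sumFin-mono λ x → sumFin-mono λ y → guarded x y
  where
  guarded : ∀ x y → (if ⌊ x <? y ⌋ then h x y else 0) ≤ (if ⌊ x <? y ⌋ then k x y else 0)
  guarded x y with x <? y
  ... | yes x<y = h≤k x y (<⇒≢ x<y)
  ... | no _    = z≤n

sumPairs-+ : ∀ {n} (h k : Fin n → Fin n → ℕ) →
  sumPairs (λ x y → h x y + k x y) ≡ sumPairs h + sumPairs k
sumPairs-+ {n} h k =
  trans (sumFin-cong λ x → trans (sumFin-cong {n} λ y → if-+ ⌊ x <? y ⌋)
                                 (sumFin-+ (λ y → if ⌊ x <? y ⌋ then h x y else 0)
                                           (λ y → if ⌊ x <? y ⌋ then k x y else 0)))
        (sumFin-+ (sumAbove h) (sumAbove k))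
  where
  if-+ : ∀ {m l} b → (if b then m + l else 0) ≡ (if b then m else 0) + (if b then l else 0)
  if-+ true  = refl
  if-+ false = refl

if-0 : ∀ b {k} → k ≡ 0 → (if b then k else 0) ≡ 0
if-0 true  k≡0 = k≡0
if-0 false k≡0 = refl

sumPairs-zero : ∀ {n} (h : Fin n → Fin n → ℕ) → (∀ x y → x ≢ y → h x y ≡ 0) → sumPairs h ≡ 0
sumPairs-zero {n} h h≗0 = trans (sumPairs-cong h≗0)
  (sumFin-zero {n} _ λ x →
    sumFin-zero {n} (λ y → if ⌊ x <? y ⌋ then 0 else 0) λ y → if-0 ⌊ x <? y ⌋ refl)

private
  inject₁<?inject₁ : ∀ {n} (x y : Fin n) → ⌊ inject₁ x <? inject₁ y ⌋ ≡ ⌊ x <? y ⌋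
  inject₁<?inject₁ x y with inject₁ x <? inject₁ y | x <? y
  ... | yes _   | yes _   = refl
  ... | no _    | no _    = refl
  ... | yes x<y | no x≮y  = ⊥-elim (x≮y (subst₂ _<_ (toℕ-inject₁ x) (toℕ-inject₁ y) x<y))
  ... | no x≮y  | yes x<y = ⊥-elim (x≮y (subst₂ _<_ (sym (toℕ-inject₁ x)) (sym (toℕ-inject₁ y)) x<y))

  inject₁<?fromℕ : ∀ {n} (x : Fin n) → ⌊ inject₁ x <? fromℕ n ⌋ ≡ true
  inject₁<?fromℕ {n} x with inject₁ x <? fromℕ n
  ... | yes _   = refl
  ... | no x≮n = ⊥-elim (x≮n (subst₂ _<_ (sym (toℕ-inject₁ x)) (sym (toℕ-fromℕ n)) (toℕ<n x)))

  fromℕ<?_ : ∀ {n} (y : Fin (suc n)) → ⌊ fromℕ n <? y ⌋ ≡ false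
  fromℕ<?_ {n} y with fromℕ n <? y
  ... | no _    = refl
  ... | yes n<y =
    ⊥-elim (<-irrefl refl (≤-trans (subst (λ k → suc k ≤ toℕ y) (toℕ-fromℕ n) n<y) (≤-pred (toℕ<n y))))

sumPairs-inject₁ : ∀ {n} (h : Fin (suc n) → Fin (suc n) → ℕ) →
  sumPairs h ≡ sumPairs (λ x y → h (inject₁ x) (inject₁ y)) + sumFin (λ x → h (inject₁ x) (fromℕ n))
sumPairs-inject₁ {n} h = begin
  sumPairs h                                                    ≡⟨ sumFin-inject₁ (sumAbove h) ⟩
  sumFin (λ x → sumAbove h (inject₁ x)) + sumAbove h (fromℕ n)  ≡⟨ cong₂ _+_ (sumFin-cong old-row) last-row ⟩
  sumFin (λ x → sumAbove old x + new x) + 0                     ≡⟨ +-identityʳ _ ⟩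
  sumFin (λ x → sumAbove old x + new x)                         ≡⟨ sumFin-+ (sumAbove old) new ⟩
  sumPairs old + sumFin new                                     ∎
  where
  open ≡-Reasoning
  old : Fin n → Fin n → ℕ
  old x y = h (inject₁ x) (inject₁ y)
  new : Fin n → ℕ
  new x = h (inject₁ x) (fromℕ n)
  old-row : ∀ x → sumAbove h (inject₁ x) ≡ sumAbove old x + new x
  old-row x = trans (sumFin-inject₁ (λ y → if ⌊ inject₁ x <? y ⌋ then h (inject₁ x) y else 0))
    (cong₂ _+_ (sumFin-cong λ y → cong (λ b → if b then old x y else 0) (inject₁<?inject₁ x y))
               (cong (λ b → if b then new x else 0) (inject₁<?fromℕ x)))
  last-row : sumAbove h (fromℕ n) ≡ 0
  last-row = sumFin-zero (λ y → if ⌊ fromℕ n <? y ⌋ then h (fromℕ n) y else 0)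
                         (λ y → cong (λ b → if b then h (fromℕ n) y else 0) (fromℕ<? y))

private
  sumFin-guarded-onlyAt : ∀ {n} (b : Fin n → Bool) (v : Fin n) k →
    sumFin (λ y → if b y then onlyAt v k y else 0) ≡ (if b v then k else 0)
  sumFin-guarded-onlyAt b v k =
    trans (sumFin-concentrated _ v λ y y≢v → if-0 (b y) (onlyAt-other k y≢v))
          (cong (λ m → if b v then m else 0) (onlyAt-self v k))

  <?-either : ∀ {n} (u y : Fin n) k → (if ⌊ u <? y ⌋ then k else 0) + (if ⌊ y <? u ⌋ then k else 0) ≤ k
  <?-either u y k with u <? y | y <? u
  ... | yes u<y | yes y<u = ⊥-elim (<-asym u<y y<u)
  ... | yes _   | no _    = ≤-reflexive (+-identityʳ k)
  ... | no _    | yes _   = ≤-refl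
  ... | no _    | no _    = z≤n

  <?-trichotomy : ∀ {n} {u v : Fin n} → u ≢ v →
    (if ⌊ u <? v ⌋ then 1 else 0) + (if ⌊ v <? u ⌋ then 1 else 0) ≡ 1
  <?-trichotomy {u = u} {v} u≢v with u <? v | v <? u
  ... | yes u<v | yes v<u = ⊥-elim (<-asym u<v v<u)
  ... | yes _   | no _    = refl
  ... | no _    | yes _   = refl
  ... | no u≮v  | no v≮u  = ⊥-elim (u≢v (toℕ-injective (≤-antisym (≮⇒≥ v≮u) (≮⇒≥ u≮v))))

sumPairs-star : ∀ {n} (u : Fin n) (g : Fin n → ℕ) →
  sumPairs (λ x y → onlyAt u (g y) x + onlyAt u (g x) y)
    ≡ sumFin (λ y → if ⌊ u <? y ⌋ then g y else 0) + sumFin (λ y → if ⌊ y <? u ⌋ then g y else 0)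
sumPairs-star {n} u g =
  trans (sumPairs-+ (λ x y → onlyAt u (g y) x) (λ x y → onlyAt u (g x) y)) (cong₂ _+_ row-u column-u)
  where
  row-u : sumPairs (λ x y → onlyAt u (g y) x) ≡ sumFin (λ y → if ⌊ u <? y ⌋ then g y else 0)
  row-u = trans (sumFin-cong rows) (sumFin-onlyAt u (λ x → sumFin (λ y → if ⌊ x <? y ⌋ then g y else 0)))
    where
    rows : ∀ x → sumAbove (λ x y → onlyAt u (g y) x) x ≡ onlyAt u (sumFin (λ y → if ⌊ x <? y ⌋ then g y else 0)) x
    rows x with x ≟ u
    ... | yes _ = refl
    ... | no _  = sumFin-zero {n} (λ y → if ⌊ x <? y ⌋ then 0 else 0) (λ y → if-0 ⌊ x <? y ⌋ refl)
  column-u : sumPairs (λ x y → onlyAt u (g x) y) ≡ sumFin (λ y → if ⌊ y <? u ⌋ then g y else 0)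
  column-u = sumFin-cong λ x → sumFin-guarded-onlyAt (λ y → ⌊ x <? y ⌋) u (g x)

sumPairs-star-≤ : ∀ {n} (u : Fin n) (g : Fin n → ℕ) →
  sumPairs (λ x y → onlyAt u (g y) x + onlyAt u (g x) y) ≤ sumFin g
sumPairs-star-≤ u g = begin
  sumPairs (λ x y → onlyAt u (g y) x + onlyAt u (g x) y)   ≡⟨ sumPairs-star u g ⟩
  sumFin (λ y → if ⌊ u <? y ⌋ then g y else 0) + sumFin (λ y → if ⌊ y <? u ⌋ then g y else 0)
    ≡⟨ sumFin-+ (λ y → if ⌊ u <? y ⌋ then g y else 0) (λ y → if ⌊ y <? u ⌋ then g y else 0) ⟨
  sumFin (λ y → (if ⌊ u <? y ⌋ then g y else 0) + (if ⌊ y <? u ⌋ then g y else 0))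
    ≤⟨ sumFin-mono (λ y → <?-either u y (g y)) ⟩
  sumFin g                                                 ∎
  where open ≤-Reasoning

isPair≡star : ∀ {n} {u v : Fin n} → u ≢ v → ∀ x y →
  𝟙 (isPair u v x y) ≡ onlyAt u (onlyAt v 1 y) x + onlyAt u (onlyAt v 1 x) y
isPair≡star {u = u} {v} u≢v x y = split ⌊ x ≟ u ⌋ ⌊ y ≟ v ⌋ ⌊ x ≟ v ⌋ ⌊ y ≟ u ⌋ not-both
  where
  not-both : ⌊ x ≟ u ⌋ ∧ ⌊ x ≟ v ⌋ ≡ false
  not-both with x ≟ u | x ≟ v
  ... | yes refl | yes refl = ⊥-elim (u≢v refl)
  ... | yes _    | no _     = refl
  ... | no _     | _        = refl
  split : ∀ a b c d → a ∧ c ≡ false → 𝟙 ((a ∧ b) ∨ (c ∧ d)) ≡ (if a then 𝟙 b else 0) + (if d then 𝟙 c else 0)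
  split true  b false true  _ = trans (cong 𝟙 (∨-identityʳ b)) (sym (+-identityʳ (𝟙 b)))
  split true  b false false _ = trans (cong 𝟙 (∨-identityʳ b)) (sym (+-identityʳ (𝟙 b)))
  split false b true  true  _ = refl
  split false b true  false _ = refl
  split false b false true  _ = refl
  split false b false false _ = refl

sumPairs-isPair : ∀ {n} {u v : Fin n} → u ≢ v → sumPairs (λ x y → 𝟙 (isPair u v x y)) ≡ 1
sumPairs-isPair {u = u} {v} u≢v = begin
  sumPairs (λ x y → 𝟙 (isPair u v x y))
    ≡⟨ sumPairs-cong (λ x y _ → isPair≡star u≢v x y) ⟩
  sumPairs (λ x y → onlyAt u (onlyAt v 1 y) x + onlyAt u (onlyAt v 1 x) y)
    ≡⟨ sumPairs-star u (onlyAt v 1) ⟩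
  sumFin (λ y → if ⌊ u <? y ⌋ then onlyAt v 1 y else 0) + sumFin (λ y → if ⌊ y <? u ⌋ then onlyAt v 1 y else 0)
    ≡⟨ cong₂ _+_ (sumFin-guarded-onlyAt (λ y → ⌊ u <? y ⌋) v 1) (sumFin-guarded-onlyAt (λ y → ⌊ y <? u ⌋) v 1) ⟩
  (if ⌊ u <? v ⌋ then 1 else 0) + (if ⌊ v <? u ⌋ then 1 else 0)
    ≡⟨ <?-trichotomy u≢v ⟩
  1 ∎
  where open ≡-Reasoning

any-cong : ∀ {A : Set} {f g : A → Bool} (xs : List A) → (∀ C → f C ≡ g C) → any f xs ≡ any g xs
any-cong []       f≗g = refl
any-cong (x ∷ xs) f≗g = cong₂ _∨_ (f≗g x) (any-cong xs f≗g)

any-map : ∀ {A B : Set} (f : B → Bool) (g : A → B) (xs : List A) → any f (map g xs) ≡ any (f ∘ g) xs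
any-map f g []       = refl
any-map f g (x ∷ xs) = cong (f (g x) ∨_) (any-map f g xs)

any-++ : ∀ {A : Set} (f : A → Bool) (xs ys : List A) → any f (xs ++ ys) ≡ any f xs ∨ any f ys
any-++ f []       ys = refl
any-++ f (x ∷ xs) ys = trans (cong (f x ∨_) (any-++ f xs ys)) (sym (∨-assoc (f x) _ _))

any-∨ : ∀ {A : Set} (f g : A → Bool) (xs : List A) → any (λ C → f C ∨ g C) xs ≡ any f xs ∨ any g xs
any-∨ f g []       = refl
any-∨ f g (x ∷ xs) = trans (cong ((f x ∨ g x) ∨_) (any-∨ f g xs)) (interchange-∨ (f x) (g x) _ _)
  where
  interchange-∨ : ∀ a b c d → (a ∨ b) ∨ (c ∨ d) ≡ (a ∨ c) ∨ (b ∨ d)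
  interchange-∨ true  b c d = refl
  interchange-∨ false true  c d = sym (∨-zeroʳ c)
  interchange-∨ false false c d = refl

any-false : ∀ {A : Set} (f : A → Bool) (xs : List A) → (∀ C → f C ≡ false) → any f xs ≡ false
any-false f []       f≗false = refl
any-false f (x ∷ xs) f≗false = cong₂ _∨_ (f≗false x) (any-false f xs f≗false)

any⇒Any : ∀ {A : Set} (f : A → Bool) (xs : List A) → any f xs ≡ true → Any (λ C → f C ≡ true) xs
any⇒Any f (x ∷ xs) any≡t with f x in fx
... | true  = here fx
... | false = there (any⇒Any f xs any≡t)

Any⇒any : ∀ {A : Set} (f : A → Bool) {xs : List A} → Any (λ C → f C ≡ true) xs → any f xs ≡ true
Any⇒any f {x ∷ xs} (here fx≡t) = cong (_∨ any f xs) fx≡t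
Any⇒any f {x ∷ xs} (there p) = trans (cong (f x ∨_) (Any⇒any f p)) (∨-zeroʳ (f x))

togetherIn-sym : ∀ {n} (Cs : List (Subset n)) x y → togetherIn Cs x y ≡ togetherIn Cs y x
togetherIn-sym Cs x y = any-cong Cs λ C → ∧-comm (lookup C x) (lookup C y)

∣∷∣ : ∀ {n} b (C : Subset n) → ∣ b ∷ C ∣ ≡ 𝟙 b + ∣ C ∣
∣∷∣ true  C = refl
∣∷∣ false C = refl

∣_∣≡sumFin : ∀ {n} (C : Subset n) → ∣ C ∣ ≡ sumFin (𝟙 ∘ lookup C)
∣ []    ∣≡sumFin = refl
∣ b ∷ C ∣≡sumFin = trans (∣∷∣ b C) (cong (𝟙 b +_) ∣ C ∣≡sumFin)

∣∷ʳ∣ : ∀ {n} (C : Subset n) b → ∣ C ∷ʳ b ∣ ≡ ∣ C ∣ + 𝟙 b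
∣∷ʳ∣ []      b = trans (∣∷∣ b []) (+-comm (𝟙 b) 0)
∣∷ʳ∣ (a ∷ C) b = begin
  ∣ a ∷ (C ∷ʳ b) ∣     ≡⟨ ∣∷∣ a (C ∷ʳ b) ⟩
  𝟙 a + ∣ C ∷ʳ b ∣     ≡⟨ cong (𝟙 a +_) (∣∷ʳ∣ C b) ⟩
  𝟙 a + (∣ C ∣ + 𝟙 b)  ≡⟨ sym (+-assoc (𝟙 a) _ _) ⟩
  𝟙 a + ∣ C ∣ + 𝟙 b    ≡⟨ cong (_+ 𝟙 b) (sym (∣∷∣ a C)) ⟩
  ∣ a ∷ C ∣ + 𝟙 b      ∎
  where open ≡-Reasoning

∣updateAt∣ : ∀ {n} (C : Subset n) u (f : Bool → Bool) →
  ∣ updateAt C u f ∣ + 𝟙 (lookup C u) ≡ ∣ C ∣ + 𝟙 (f (lookup C u))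
∣updateAt∣ (a ∷ C) fzero f = begin
  ∣ f a ∷ C ∣ + 𝟙 a      ≡⟨ cong (_+ 𝟙 a) (∣∷∣ (f a) C) ⟩
  𝟙 (f a) + ∣ C ∣ + 𝟙 a  ≡⟨ xy∙z≈zy∙x (𝟙 (f a)) ∣ C ∣ (𝟙 a) ⟩
  𝟙 a + ∣ C ∣ + 𝟙 (f a)  ≡⟨ cong (_+ 𝟙 (f a)) (∣∷∣ a C) ⟨
  ∣ a ∷ C ∣ + 𝟙 (f a)    ∎
  where open ≡-Reasoning
∣updateAt∣ (a ∷ C) (fsuc u) f = begin
  ∣ a ∷ updateAt C u f ∣ + 𝟙 (lookup C u)   ≡⟨ cong (_+ 𝟙 (lookup C u)) (∣∷∣ a (updateAt C u f)) ⟩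
  𝟙 a + ∣ updateAt C u f ∣ + 𝟙 (lookup C u) ≡⟨ +-assoc (𝟙 a) _ _ ⟩
  𝟙 a + (∣ updateAt C u f ∣ + 𝟙 (lookup C u)) ≡⟨ cong (𝟙 a +_) (∣updateAt∣ C u f) ⟩
  𝟙 a + (∣ C ∣ + 𝟙 (f (lookup C u)))       ≡⟨ sym (+-assoc (𝟙 a) _ _) ⟩
  𝟙 a + ∣ C ∣ + 𝟙 (f (lookup C u))         ≡⟨ cong (_+ 𝟙 (f (lookup C u))) (sym (∣∷∣ a C)) ⟩
  ∣ a ∷ C ∣ + 𝟙 (f (lookup C u))           ∎
  where open ≡-Reasoning

lookup-∷ʳ-inject₁ : ∀ {A : Set} {n} (C : Vec A n) b x → lookup (C ∷ʳ b) (inject₁ x) ≡ lookup C x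
lookup-∷ʳ-inject₁ (a ∷ C) b fzero    = refl
lookup-∷ʳ-inject₁ (a ∷ C) b (fsuc x) = lookup-∷ʳ-inject₁ C b x

lookup-∷ʳ-fromℕ : ∀ {A : Set} {n} (C : Vec A n) b → lookup (C ∷ʳ b) (fromℕ n) ≡ b
lookup-∷ʳ-fromℕ []      b = refl
lookup-∷ʳ-fromℕ (a ∷ C) b = lookup-∷ʳ-fromℕ C b

data InjectOrLast {n} : Fin (suc n) → Set where
  oldVertex  : (x : Fin n) → InjectOrLast (inject₁ x)
  lastVertex : InjectOrLast (fromℕ n)

injectOrLast : ∀ {n} (i : Fin (suc n)) → InjectOrLast i
injectOrLast {zero}  fzero    = lastVertex
injectOrLast {suc n} fzero    = oldVertex fzero
injectOrLast {suc n} (fsuc i) with injectOrLast i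
... | oldVertex x = oldVertex (fsuc x)
... | lastVertex  = lastVertex

multiplicity : ∀ {n} → Fin n → List (Subset n) → ℕ
multiplicity x Cs = sum (map (λ C → 𝟙 (lookup C x)) Cs)

totalSize : ∀ {n} → List (Subset n) → ℕ
totalSize Cs = sum (map ∣_∣ Cs)

totalSize≡sumFin-multiplicity : ∀ {n} (Cs : List (Subset n)) → totalSize Cs ≡ sumFin (λ x → multiplicity x Cs)
totalSize≡sumFin-multiplicity {n} [] = sym (sumFin-zero {n} (λ _ → 0) λ _ → refl)
totalSize≡sumFin-multiplicity (C ∷ Cs) =
  trans (cong₂ _+_ ∣ C ∣≡sumFin (totalSize≡sumFin-multiplicity Cs))
        (sym (sumFin-+ (𝟙 ∘ lookup C) (λ x → multiplicity x Cs)))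

totalSize-++ : ∀ {n} (Cs Ds : List (Subset n)) → totalSize (Cs ++ Ds) ≡ totalSize Cs + totalSize Ds
totalSize-++ Cs Ds = trans (cong sum (map-++ ∣_∣ Cs Ds)) (sum-++ (map ∣_∣ Cs) (map ∣_∣ Ds))

totalSize-map : ∀ {n m} (f : Subset n → Subset m) (Cs : List (Subset n)) →
  (∀ C → ∣ f C ∣ ≤ ∣ C ∣) → totalSize (map f Cs) ≤ totalSize Cs
totalSize-map f []       ∣f∣≤ = z≤n
totalSize-map f (C ∷ Cs) ∣f∣≤ = +-mono-≤ (∣f∣≤ C) (totalSize-map f Cs ∣f∣≤)

totalSize-map-≡ : ∀ {n m} (f : Subset n → Subset m) (Cs : List (Subset n)) →
  (∀ C → ∣ f C ∣ ≡ ∣ C ∣) → totalSize (map f Cs) ≡ totalSize Cs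
totalSize-map-≡ f []       ∣f∣≡ = refl
totalSize-map-≡ f (C ∷ Cs) ∣f∣≡ = cong₂ _+_ (∣f∣≡ C) (totalSize-map-≡ f Cs ∣f∣≡)

Covers : ∀ n → List (Subset n) → Set
Covers n Cs = ∀ (x : Fin n) → Any (λ C → lookup C x ≡ true) Cs

Any⇒multiplicity : ∀ {n} {x : Fin n} {Cs} → Any (λ C → lookup C x ≡ true) Cs → 1 ≤ multiplicity x Cs
Any⇒multiplicity {x = x} (here x∈C) rewrite x∈C = s≤s z≤n
Any⇒multiplicity {x = x} {C ∷ Cs} (there p) = ≤-trans (Any⇒multiplicity p) (m≤n+m _ (𝟙 (lookup C x)))

multiplicity⇒Any : ∀ {n} (x : Fin n) (Cs : List (Subset n)) →
  1 ≤ multiplicity x Cs → Any (λ C → lookup C x ≡ true) Cs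
multiplicity⇒Any x (C ∷ Cs) 1≤m with lookup C x in x∈C
... | true  = here x∈C
... | false = there (multiplicity⇒Any x Cs 1≤m)

totalSize-cover : ∀ {n} {Cs : List (Subset n)} → Covers n Cs → n ≤ totalSize Cs
totalSize-cover {n} {Cs} cov =
  subst₂ _≤_ (sumFin-one n) (sym (totalSize≡sumFin-multiplicity Cs)) (sumFin-mono (Any⇒multiplicity ∘ cov))

totalSize-cover-shared : ∀ {n} {Cs : List (Subset n)} → Covers n Cs → (u : Fin n) → 2 ≤ multiplicity u Cs →
  n < totalSize Cs
totalSize-cover-shared {n} {Cs} cov u 2≤m =
  subst₂ _<_ (sumFin-one n) (sym (totalSize≡sumFin-multiplicity Cs))
    (sumFin-mono-< u (Any⇒multiplicity ∘ cov) 2≤m)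

mismatch : ∀ {n} → Graph n → List (Subset n) → Fin n → Fin n → ℕ
mismatch G Cs x y = 𝟙 (adj G x y xor togetherIn Cs x y)

disagreements : ∀ {n} → Graph n → List (Subset n) → ℕ
disagreements G Cs = sumPairs (mismatch G Cs)

cost≡ : ∀ {n} (G : Graph n) Cs → cost G Cs ≡ disagreements G Cs + totalSize Cs ∸ n
cost≡ {n} G Cs = cong (λ d → d + totalSize Cs ∸ n) (begin
  countPairs (λ x y → not (adj G x y) ∧ togetherIn Cs x y)
    + countPairs (λ x y → adj G x y ∧ not (togetherIn Cs x y))
    ≡⟨ cong₂ _+_ (countPairs≡sumPairs (λ x y → not (adj G x y) ∧ togetherIn Cs x y))
                 (countPairs≡sumPairs (λ x y → adj G x y ∧ not (togetherIn Cs x y))) ⟩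
  sumPairs missing + sumPairs extra
    ≡⟨ sumPairs-+ missing extra ⟨
  sumPairs (λ x y → missing x y + extra x y)
    ≡⟨ sumPairs-cong (λ x y _ → either (adj G x y) (togetherIn Cs x y)) ⟩
  disagreements G Cs ∎)
  where
  open ≡-Reasoning
  missing extra : Fin n → Fin n → ℕ
  missing x y = 𝟙 (not (adj G x y) ∧ togetherIn Cs x y)
  extra   x y = 𝟙 (adj G x y ∧ not (togetherIn Cs x y))
  either : ∀ a t → 𝟙 (not a ∧ t) + 𝟙 (a ∧ not t) ≡ 𝟙 (a xor t)
  either true  true  = refl
  either true  false = refl
  either false true  = refl
  either false false = refl

cost≤⇔ : ∀ {n} (G : Graph n) Cs k → cost G Cs ≤ k ⇔ disagreements G Cs + totalSize Cs ≤ k + n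
cost≤⇔ {n} G Cs k = mk⇔
  (λ c≤k → ≤-trans (m≤n+m∸n _ n)
                   (subst (_≤ k + n) (+-comm _ n) (+-monoˡ-≤ n (subst (_≤ k) (cost≡ G Cs) c≤k))))
  (λ d+s≤ → subst (_≤ k) (sym (cost≡ G Cs)) (≤-trans (∸-monoˡ-≤ n d+s≤) (≤-reflexive (m+n∸n≡m k n))))

Agrees : ∀ {n} → Graph n → List (Subset n) → Set
Agrees {n} G Cs = ∀ (x y : Fin n) → x ≢ y → adj G x y ≡ togetherIn Cs x y

disagreements-agree : ∀ {n} {G : Graph n} {Cs} → Agrees G Cs → disagreements G Cs ≡ 0
disagreements-agree {G = G} {Cs} agree =
  sumPairs-zero (mismatch G Cs) λ x y x≢y →
    cong 𝟙 (trans (cong (_xor togetherIn Cs x y) (agree x y x≢y)) (xor-same (togetherIn Cs x y)))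

coverGraph : ∀ {n} → List (Subset n) → Graph n
coverGraph Cs = record
  { adj    = λ x y → togetherIn Cs x y ∧ not ⌊ x ≟ y ⌋
  ; sym    = λ x y → cong₂ (λ t e → t ∧ not e) (togetherIn-sym Cs x y) (≟-sym x y)
  ; irrefl = λ x → trans (cong (λ e → togetherIn Cs x x ∧ not e) (≟-refl x)) (∧-zeroʳ _)
  }

coverGraph-agrees : ∀ {n} (Cs : List (Subset n)) → Agrees (coverGraph Cs) Cs
coverGraph-agrees Cs x y x≢y = trans (cong (λ e → togetherIn Cs x y ∧ not e) (≟-≢ x≢y)) (∧-identityʳ _)

_≟ˢ_ : ∀ {n} (C D : Subset n) → Dec (C ≡ D)
_≟ˢ_ = ≡-dec Bool._≟_

dedup : ∀ {n} → List (Subset n) → List (Subset n)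
dedup = deduplicate _≟ˢ_

Any-dedup⁺ : ∀ {n} {P : Subset n → Set} {Cs} → Any P Cs → Any P (dedup Cs)
Any-dedup⁺ = Anyₚ.deduplicate⁺ _≟ˢ_ λ { refl p → p }

any-dedup : ∀ {n} (f : Subset n → Bool) (Cs : List (Subset n)) → any f (dedup Cs) ≡ any f Cs
any-dedup f Cs = bool-ext
  (λ any≡t → Any⇒any f (Anyₚ.deduplicate⁻ _≟ˢ_ (any⇒Any f (dedup Cs) any≡t)))
  (λ any≡t → Any⇒any f (Any-dedup⁺ (any⇒Any f Cs any≡t)))

disagreements-dedup : ∀ {n} (G : Graph n) Cs → disagreements G (dedup Cs) ≡ disagreements G Cs
disagreements-dedup G Cs =
  sumPairs-cong λ x y _ → cong (λ t → 𝟙 (adj G x y xor t)) (any-dedup (λ C → lookup C x ∧ lookup C y) Cs)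

totalSize-filter : ∀ {n p} {P : Pred (Subset n) p} (P? : Decidable P) Cs →
  totalSize (filter P? Cs) ≤ totalSize Cs
totalSize-filter P? []       = z≤n
totalSize-filter P? (C ∷ Cs) with does (P? C)
... | true  = +-monoʳ-≤ ∣ C ∣ (totalSize-filter P? Cs)
... | false = ≤-trans (totalSize-filter P? Cs) (m≤n+m _ ∣ C ∣)

totalSize-dedup : ∀ {n} (Cs : List (Subset n)) → totalSize (dedup Cs) ≤ totalSize Cs
totalSize-dedup []       = z≤n
totalSize-dedup (C ∷ Cs) =
  +-monoʳ-≤ ∣ C ∣ (≤-trans (totalSize-filter (λ D → ¬? (C ≟ˢ D)) (dedup Cs)) (totalSize-dedup Cs))

isPair-sym : ∀ {n} (u v x y : Fin n) → isPair u v x y ≡ isPair u v y x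
isPair-sym u v x y =
  trans (∨-comm (⌊ x ≟ u ⌋ ∧ ⌊ y ≟ v ⌋) _) (cong₂ _∨_ (∧-comm ⌊ x ≟ v ⌋ _) (∧-comm ⌊ x ≟ u ⌋ _))

isPair-diagonal : ∀ {n} {u v : Fin n} → u ≢ v → ∀ x → isPair u v x x ≡ false
isPair-diagonal {u = u} {v} u≢v x with x ≟ u | x ≟ v
... | yes refl | yes refl = ⊥-elim (u≢v refl)
... | yes _    | no _     = refl
... | no _     | yes _    = refl
... | no _     | no _     = refl

isPair-resp : ∀ {n} {A : Set} (f : Fin n → Fin n → A) → (∀ x y → f x y ≡ f y x) →
  ∀ {u v x y} → isPair u v x y ≡ true → f x y ≡ f u v
isPair-resp f f-sym {u} {v} {x} {y} pair with x ≟ u | y ≟ v | x ≟ v | y ≟ u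
... | yes refl | yes refl | _        | _        = refl
... | _        | _        | yes refl | yes refl = f-sym x y
... | yes _    | no _     | yes _    | no _     with () ← pair
... | yes _    | no _     | no _     | _        with () ← pair
... | no _     | _        | yes _    | no _     with () ← pair
... | no _     | _        | no _     | _        with () ← pair

isPair-adj : ∀ {n} (G : Graph n) {u v x y} → isPair u v x y ≡ true → adj G x y ≡ adj G u v
isPair-adj G = isPair-resp (adj G) (Graph.sym G)

Toggles : ∀ {n} → Graph n → Graph n → Fin n → Fin n → Set
Toggles {n} G H u v = ∀ (x y : Fin n) → adj H x y ≡ adj G x y xor isPair u v x y

toggle : ∀ {n} (G : Graph n) (u v : Fin n) → u ≢ v → Graph n
toggle G u v u≢v = record
  { adj    = λ x y → adj G x y xor isPair u v x y
  ; sym    = λ x y → cong₂ _xor_ (Graph.sym G x y) (isPair-sym u v x y)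
  ; irrefl = λ x → cong₂ _xor_ (irrefl G x) (isPair-diagonal u≢v x)
  }

toggle-toggles : ∀ {n} (G : Graph n) {u v} (u≢v : u ≢ v) → Toggles G (toggle G u v u≢v) u v
toggle-toggles G u≢v x y = refl

private
  ∨≡xor : ∀ a p → (p ≡ true → a ≡ false) → a ∨ p ≡ a xor p
  ∨≡xor true  true  p⇒¬a = p⇒¬a refl
  ∨≡xor true  false _    = refl
  ∨≡xor false p     _    = refl

  ∧not≡xor : ∀ a p → (p ≡ true → a ≡ true) → a ∧ not p ≡ a xor p
  ∧not≡xor true  p     _   = refl
  ∧not≡xor false true  p⇒a = p⇒a refl
  ∧not≡xor false false _   = refl

edgeAddition-toggles : ∀ {n} (G H : Graph n) {u v} → adj G u v ≡ false →
  (∀ x y → adj H x y ≡ (adj G x y ∨ isPair u v x y)) → Toggles G H u v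
edgeAddition-toggles G H {u} {v} uv∉G H≡G+uv x y =
  trans (H≡G+uv x y) (∨≡xor (adj G x y) (isPair u v x y) λ pair → trans (isPair-adj G pair) uv∉G)

edgeDeletion-toggles : ∀ {n} (G H : Graph n) {u v} → adj G u v ≡ true →
  (∀ x y → adj H x y ≡ (adj G x y ∧ not (isPair u v x y))) → Toggles G H u v
edgeDeletion-toggles G H {u} {v} uv∈G H≡G-uv x y =
  trans (H≡G-uv x y) (∧not≡xor (adj G x y) (isPair u v x y) λ pair → trans (isPair-adj G pair) uv∈G)

toggle-modification : ∀ {n} (G : Graph n) (u v : Fin n) (u≢v : u ≢ v) → Modification G (toggle G u v u≢v)
toggle-modification G u v u≢v with adj G u v in uv∈G
... | false = edgeAddition u v u≢v uv∈G (toggle G u v u≢v) λ x y →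
  sym (∨≡xor (adj G x y) (isPair u v x y) λ pair → trans (isPair-adj G pair) uv∈G)
... | true  = edgeDeletion u v uv∈G (toggle G u v u≢v) λ x y →
  sym (∧not≡xor (adj G x y) (isPair u v x y) λ pair → trans (isPair-adj G pair) uv∈G)

adjacent⇒≢ : ∀ {n} (G : Graph n) {u v} → adj G u v ≡ true → u ≢ v
adjacent⇒≢ G {u} uv∈G refl with () ← trans (sym (irrefl G u)) uv∈G

disagreements+pair : ∀ {n} (H : Graph n) Cs {u v : Fin n} → u ≢ v →
  sumPairs (λ x y → mismatch H Cs x y + 𝟙 (isPair u v x y)) ≡ disagreements H Cs + 1
disagreements+pair H Cs {u} {v} u≢v =
  trans (sumPairs-+ (mismatch H Cs) (λ x y → 𝟙 (isPair u v x y))) (cong (disagreements H Cs +_) (sumPairs-isPair u≢v))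

disagreements-toggle-≤ : ∀ {n} (G H : Graph n) {u v} → Toggles G H u v → u ≢ v →
  ∀ Cs → disagreements G Cs ≤ disagreements H Cs + 1
disagreements-toggle-≤ G H {u} {v} toggles u≢v Cs = begin
  disagreements G Cs
    ≤⟨ sumPairs-mono (λ x y _ →
         subst (λ h → mismatch G Cs x y ≤ 𝟙 (h xor togetherIn Cs x y) + 𝟙 (isPair u v x y)) (sym (toggles x y))
               (triangle (adj G x y) (isPair u v x y) (togetherIn Cs x y))) ⟩
  sumPairs (λ x y → mismatch H Cs x y + 𝟙 (isPair u v x y))
    ≡⟨ disagreements+pair H Cs u≢v ⟩
  disagreements H Cs + 1 ∎
  where
  open ≤-Reasoning
  triangle : ∀ a p t → 𝟙 (a xor t) ≤ 𝟙 ((a xor p) xor t) + 𝟙 p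
  triangle true  true  true  = z≤n
  triangle true  true  false = ≤-refl
  triangle true  false t     = m≤m+n _ 0
  triangle false true  true  = s≤s z≤n
  triangle false true  false = z≤n
  triangle false false t     = m≤m+n _ 0

disagreements-toggle : ∀ {n} (G H : Graph n) {u v} → Toggles G H u v → u ≢ v →
  ∀ Cs → adj G u v xor togetherIn Cs u v ≡ true → disagreements G Cs ≡ disagreements H Cs + 1
disagreements-toggle G H {u} {v} toggles u≢v Cs uv-wrong = begin
  disagreements G Cs
    ≡⟨ sumPairs-cong (λ x y _ →
         trans (repaired (adj G x y) (isPair u v x y) (togetherIn Cs x y) (wrong x y))
               (cong (λ h → 𝟙 (h xor togetherIn Cs x y) + 𝟙 (isPair u v x y)) (sym (toggles x y)))) ⟩
  sumPairs (λ x y → mismatch H Cs x y + 𝟙 (isPair u v x y))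
    ≡⟨ disagreements+pair H Cs u≢v ⟩
  disagreements H Cs + 1 ∎
  where
  open ≡-Reasoning
  wrong : ∀ x y → isPair u v x y ≡ true → adj G x y xor togetherIn Cs x y ≡ true
  wrong x y pair = trans (isPair-resp (λ x y → adj G x y xor togetherIn Cs x y)
                                      (λ x y → cong₂ _xor_ (Graph.sym G x y) (togetherIn-sym Cs x y)) pair) uv-wrong
  repaired : ∀ a p t → (p ≡ true → a xor t ≡ true) → 𝟙 (a xor t) ≡ 𝟙 ((a xor p) xor t) + 𝟙 p
  repaired true  true  true  wrong with () ← wrong refl
  repaired true  true  false _     = refl
  repaired true  false t     _     = sym (+-identityʳ _)
  repaired false true  true  _     = refl
  repaired false true  false wrong with () ← wrong refl
  repaired false false t     _     = sym (+-identityʳ _)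

-- Covers of cluster graphs

multiplicity-unique : ∀ {n} (x : Fin n) (D : Subset n) {Cs : List (Subset n)} → Unique Cs →
  All (λ C → lookup C x ≡ true → C ≡ D) Cs → multiplicity x Cs ≤ 1
multiplicity-unique x D []                [] = z≤n
multiplicity-unique x D {C ∷ Cs} (C≢ ∷ unique) (C≡D ∷ Cs≡D) with lookup C x
... | true  = ≤-reflexive (cong suc (absent C≢ Cs≡D))
  where
  absent : ∀ {Ds} → All (C ≢_) Ds → All (λ C → lookup C x ≡ true → C ≡ D) Ds → multiplicity x Ds ≡ 0
  absent []            []              = refl
  absent {E ∷ Ds} (C≢E ∷ C≢Ds) (E≡D ∷ Ds≡D) with lookup E x
  ... | true  = ⊥-elim (C≢E (trans (C≡D refl) (sym (E≡D refl))))
  ... | false = absent C≢Ds Ds≡D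
... | false = multiplicity-unique x D unique Cs≡D

module ClusterCover {n} (G : Graph n) (cluster : IsCluster G) where

  inN : Fin n → Fin n → Bool
  inN z y = ⌊ y ≟ z ⌋ ∨ adj G z y

  N[_] : Fin n → Subset n
  N[ z ] = tabulate (inN z)

  inN-refl : ∀ z → inN z z ≡ true
  inN-refl z = cong (_∨ adj G z z) (≟-refl z)

  adj⇒inN : ∀ {z y} → adj G z y ≡ true → inN z y ≡ true
  adj⇒inN {z} {y} zy∈G = trans (cong (⌊ y ≟ z ⌋ ∨_) zy∈G) (∨-zeroʳ _)

  inN⇒ : ∀ {z y} → inN z y ≡ true → y ≡ z ⊎ adj G z y ≡ true
  inN⇒ {z} {y} zy∈N with y ≟ z
  ... | yes y≡z = inj₁ y≡z
  ... | no _    = inj₂ zy∈N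

  inN⇒adj : ∀ {z y} → y ≢ z → inN z y ≡ true → adj G z y ≡ true
  inN⇒adj y≢z zy∈N with inN⇒ zy∈N
  ... | inj₁ y≡z  = ⊥-elim (y≢z y≡z)
  ... | inj₂ zy∈G = zy∈G

  inN-sym : ∀ z y → inN z y ≡ inN y z
  inN-sym z y = cong₂ _∨_ (≟-sym y z) (Graph.sym G z y)

  inN-trans : ∀ {z x y} → inN z x ≡ true → inN x y ≡ true → inN z y ≡ true
  inN-trans {z} {x} {y} zx∈N xy∈N with inN⇒ zx∈N | inN⇒ xy∈N
  ... | inj₁ refl | _        = xy∈N
  ... | _         | inj₁ refl = zx∈N
  ... | inj₂ zx∈G | inj₂ xy∈G with y ≟ z
  ...   | yes _  = refl
  ...   | no y≢z = cluster z y (y≢z ∘ sym) (step zx∈G (step xy∈G here))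

  N[]-≡ : ∀ {z x} → inN z x ≡ true → N[ z ] ≡ N[ x ]
  N[]-≡ {z} {x} zx∈N = tabulate-cong λ y → bool-ext
    (λ zy∈N → inN-trans (trans (inN-sym x z) zx∈N) zy∈N)
    (inN-trans zx∈N)

  neighbourhoods : List (Subset n)
  neighbourhoods = dedup (map N[_] (allFin n))

  ∈neighbourhoods : ∀ {C} → C ∈ neighbourhoods → ∃ λ z → C ≡ N[ z ]
  ∈neighbourhoods C∈ with ∈-map⁻ N[_] (∈-deduplicate⁻ _≟ˢ_ (map N[_] (allFin n)) C∈)
  ... | z , _ , C≡N[z] = z , C≡N[z]

  lookup-N[] : ∀ z y → lookup N[ z ] y ≡ inN z y
  lookup-N[] z y = lookup∘tabulate (inN z) y

  covers : Covers n neighbourhoods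
  covers x = Any-dedup⁺ (Anyₚ.gmap (λ { refl → trans (lookup-N[] x x) (inN-refl x) }) (∈-allFin x))

  agrees : Agrees G neighbourhoods
  agrees x y x≢y = bool-ext
    (λ xy∈G → Any⇒any together (Any-dedup⁺ (Anyₚ.gmap (λ { refl → in-N[x] xy∈G }) (∈-allFin x))))
    (λ xy∈Cs →
      witness (satisfied (Anyₚ.map⁻ (Anyₚ.deduplicate⁻ _≟ˢ_ (any⇒Any together neighbourhoods xy∈Cs)))))
    where
    together : Subset n → Bool
    together C = lookup C x ∧ lookup C y
    in-N[x] : adj G x y ≡ true → together N[ x ] ≡ true
    in-N[x] xy∈G = cong₂ _∧_ (trans (lookup-N[] x x) (inN-refl x)) (trans (lookup-N[] x y) (adj⇒inN xy∈G))
    witness : (∃ λ z → together N[ z ] ≡ true) → adj G x y ≡ true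
    witness (z , xy∈N[z]) with lookup N[ z ] x in x∈N[z] | lookup N[ z ] y in y∈N[z]
    witness (z , refl) | true | true = inN⇒adj (x≢y ∘ sym)
      (inN-trans (trans (inN-sym x z) (trans (sym (lookup-N[] z x)) x∈N[z]))
                 (trans (sym (lookup-N[] z y)) y∈N[z]))

  members-containing : ∀ x → All (λ C → lookup C x ≡ true → C ≡ N[ x ]) neighbourhoods
  members-containing x = All.tabulate λ C∈ x∈C → containing (∈neighbourhoods C∈) x∈C
    where
    containing : ∀ {C} → (∃ λ z → C ≡ N[ z ]) → lookup C x ≡ true → C ≡ N[ x ]
    containing (z , refl) x∈N[z] = N[]-≡ (trans (sym (lookup-N[] z x)) x∈N[z])

  totalSize-neighbourhoods : totalSize neighbourhoods ≤ n
  totalSize-neighbourhoods =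
    subst₂ _≤_ (sym (totalSize≡sumFin-multiplicity neighbourhoods)) (sumFin-one n)
      (sumFin-mono λ x →
        multiplicity-unique x N[ x ] (deduplicate-! _≟ˢ_ (map N[_] (allFin n))) (members-containing x))

cluster-cover : ∀ {n} (G : Graph n) → IsCluster G →
  Σ (List (Subset n)) λ Cs → Covers n Cs × disagreements G Cs + totalSize Cs ≤ 0 + n
cluster-cover G cluster =
  neighbourhoods , covers ,
  subst (λ d → d + totalSize neighbourhoods ≤ _) (sym (disagreements-agree {G = G} {neighbourhoods} agrees))
        totalSize-neighbourhoods
  where open ClusterCover G cluster

-- Pulling a cover back along a vertex split

lookup-init : ∀ {A : Set} {n} (C : Vec A (suc n)) x → lookup (init C) x ≡ lookup C (inject₁ x)
lookup-init C x with initLast C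
... | D , b , refl = sym (lookup-∷ʳ-inject₁ D b x)

last≡lookup-fromℕ : ∀ {A : Set} {n} (C : Vec A (suc n)) → last C ≡ lookup C (fromℕ n)
last≡lookup-fromℕ C with initLast C
... | D , b , refl = sym (lookup-∷ʳ-fromℕ D b)

-- the image of C under the map Fin (suc n) → Fin n that sends the last vertex to u
mergeLast : ∀ {n} → Fin n → Subset (suc n) → Subset n
mergeLast u C = updateAt (init C) u (_∨ last C)

mergeLast-other : ∀ {n} {u x : Fin n} (C : Subset (suc n)) → x ≢ u →
  lookup (mergeLast u C) x ≡ lookup C (inject₁ x)
mergeLast-other {u = u} {x} C x≢u = trans (lookup∘updateAt′ x u x≢u (init C)) (lookup-init C x)

mergeLast-at : ∀ {n} (u : Fin n) (C : Subset (suc n)) →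
  lookup (mergeLast u C) u ≡ lookup C (inject₁ u) ∨ lookup C (fromℕ n)
mergeLast-at u C = trans (lookup∘updateAt u (init C)) (cong₂ _∨_ (lookup-init C u) (last≡lookup-fromℕ C))

mergeLast-⊇ : ∀ {n} (u : Fin n) (C : Subset (suc n)) x →
  lookup C (inject₁ x) ≡ true → lookup (mergeLast u C) x ≡ true
mergeLast-⊇ u C x x∈C with x ≟ u
... | yes refl = trans (mergeLast-at u C) (cong (_∨ lookup C (fromℕ _)) x∈C)
... | no x≢u   = trans (mergeLast-other C x≢u) x∈C

∣mergeLast∣ : ∀ {n} (u : Fin n) (C : Subset (suc n)) → ∣ mergeLast u C ∣ ≤ ∣ C ∣
∣mergeLast∣ u C with initLast C
... | D , b , refl rewrite ∣∷ʳ∣ D b = +-cancelʳ-≤ (𝟙 a) _ _ (begin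
  ∣ updateAt D u (_∨ b) ∣ + 𝟙 a   ≡⟨ ∣updateAt∣ D u (_∨ b) ⟩
  ∣ D ∣ + 𝟙 (a ∨ b)               ≤⟨ +-monoʳ-≤ ∣ D ∣ (𝟙-∨ a b) ⟩
  ∣ D ∣ + (𝟙 b + 𝟙 a)             ≡⟨ sym (+-assoc ∣ D ∣ _ _) ⟩
  ∣ D ∣ + 𝟙 b + 𝟙 a               ∎)
  where
  open ≤-Reasoning
  a : Bool
  a = lookup D u
  𝟙-∨ : ∀ a b → 𝟙 (a ∨ b) ≤ 𝟙 b + 𝟙 a
  𝟙-∨ true  b = m≤n+m 1 (𝟙 b)
  𝟙-∨ false b = m≤m+n (𝟙 b) 0

module SplitPullback {n} {G : Graph n} {u : Fin n} {H : Graph (suc n)}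
  (unchanged : ∀ x y → x ≢ u → y ≢ u → adj H (inject₁ x) (inject₁ y) ≡ adj G x y)
  (divided : ∀ x → x ≢ u → adj G u x ≡ (adj H (inject₁ u) (inject₁ x) ∨ adj H (fromℕ n) (inject₁ x)))
  (Cs′ : List (Subset (suc n))) where

  Cs : List (Subset n)
  Cs = map (mergeLast u) Cs′

  covers : Covers (suc n) Cs′ → Covers n Cs
  covers cov x = Anyₚ.gmap (mergeLast-⊇ u _ x) (cov (inject₁ x))

  totalSize-≤ : totalSize Cs ≤ totalSize Cs′
  totalSize-≤ = totalSize-map (mergeLast u) Cs′ (∣mergeLast∣ u)

  private
    together′ : Fin (suc n) → Fin (suc n) → Subset (suc n) → Bool
    together′ i j C = lookup C i ∧ lookup C j

    together-other : ∀ {x y} → x ≢ u → y ≢ u → togetherIn Cs x y ≡ togetherIn Cs′ (inject₁ x) (inject₁ y)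
    together-other {x} {y} x≢u y≢u = trans (any-map (λ C → lookup C x ∧ lookup C y) (mergeLast u) Cs′)
      (any-cong Cs′ λ C → cong₂ _∧_ (mergeLast-other C x≢u) (mergeLast-other C y≢u))

    together-at : ∀ {y} → y ≢ u →
      togetherIn Cs u y ≡ togetherIn Cs′ (inject₁ u) (inject₁ y) ∨ togetherIn Cs′ (fromℕ n) (inject₁ y)
    together-at {y} y≢u = begin
      togetherIn Cs u y
        ≡⟨ any-map (λ C → lookup C u ∧ lookup C y) (mergeLast u) Cs′ ⟩
      any (λ C → lookup (mergeLast u C) u ∧ lookup (mergeLast u C) y) Cs′
        ≡⟨ any-cong Cs′ (λ C → trans (cong₂ _∧_ (mergeLast-at u C) (mergeLast-other C y≢u))
                                     (∧-distribʳ-∨ (lookup C (inject₁ y)) (lookup C (inject₁ u)) _)) ⟩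
      any (λ C → together′ (inject₁ u) (inject₁ y) C ∨ together′ (fromℕ n) (inject₁ y) C) Cs′
        ≡⟨ any-∨ (together′ (inject₁ u) (inject₁ y)) (together′ (fromℕ n) (inject₁ y)) Cs′ ⟩
      togetherIn Cs′ (inject₁ u) (inject₁ y) ∨ togetherIn Cs′ (fromℕ n) (inject₁ y) ∎
      where open ≡-Reasoning

    mismatch-∨ : ∀ a b t s → 𝟙 ((a ∨ b) xor (t ∨ s)) ≤ 𝟙 (a xor t) + 𝟙 (b xor s)
    mismatch-∨ true  b     true  s     = z≤n
    mismatch-∨ true  b     false true  = m≤m+n _ _
    mismatch-∨ true  b     false false = m≤m+n _ _
    mismatch-∨ false true  true  s     = z≤n
    mismatch-∨ false true  false true  = m≤n+m _ _
    mismatch-∨ false true  false false = m≤n+m 1 0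
    mismatch-∨ false false true  s     = m≤m+n _ _
    mismatch-∨ false false false true  = ≤-refl
    mismatch-∨ false false false false = z≤n

    mismatch-sym : ∀ {m} (K : Graph m) Ds x y → mismatch K Ds x y ≡ mismatch K Ds y x
    mismatch-sym K Ds x y = cong₂ (λ a t → 𝟙 (a xor t)) (Graph.sym K x y) (togetherIn-sym Ds x y)

    old : Fin n → Fin n → ℕ
    old x y = mismatch H Cs′ (inject₁ x) (inject₁ y)

    new : Fin n → ℕ
    new x = mismatch H Cs′ (inject₁ x) (fromℕ n)

    mismatch-at : ∀ {y} → y ≢ u → mismatch G Cs u y ≤ old u y + new y
    mismatch-at {y} y≢u rewrite divided y y≢u | together-at y≢u | mismatch-sym H Cs′ (inject₁ y) (fromℕ n) =
      mismatch-∨ (adj H (inject₁ u) (inject₁ y)) (adj H (fromℕ n) (inject₁ y))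
                 (togetherIn Cs′ (inject₁ u) (inject₁ y)) (togetherIn Cs′ (fromℕ n) (inject₁ y))

    mismatch-≤ : ∀ x y → x ≢ y → mismatch G Cs x y ≤ old x y + (onlyAt u (new y) x + onlyAt u (new x) y)
    mismatch-≤ x y x≢y with x ≟ u | y ≟ u
    ... | yes refl | yes refl = ⊥-elim (x≢y refl)
    ... | yes refl | no y≢u rewrite +-identityʳ (new y) = mismatch-at y≢u
    ... | no x≢u   | yes refl
      rewrite mismatch-sym G Cs x u | mismatch-sym H Cs′ (inject₁ x) (inject₁ u) = mismatch-at x≢u
    ... | no x≢u   | no y≢u rewrite unchanged x y x≢u y≢u | together-other x≢u y≢u = m≤m+n _ _

  disagreements-≤ : disagreements G Cs ≤ disagreements H Cs′
  disagreements-≤ = begin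
    disagreements G Cs
      ≤⟨ sumPairs-mono mismatch-≤ ⟩
    sumPairs (λ x y → old x y + (onlyAt u (new y) x + onlyAt u (new x) y))
      ≡⟨ sumPairs-+ old (λ x y → onlyAt u (new y) x + onlyAt u (new x) y) ⟩
    sumPairs old + sumPairs (λ x y → onlyAt u (new y) x + onlyAt u (new x) y)
      ≤⟨ +-monoʳ-≤ (sumPairs old) (sumPairs-star-≤ u new) ⟩
    sumPairs old + sumFin new
      ≡⟨ sumPairs-inject₁ (mismatch H Cs′) ⟨
    disagreements H Cs′ ∎
    where open ≤-Reasoning

-- From a cluster editing sequence to a cover

edge-budget : ∀ {d d′} s k n → d ≤ d′ + 1 → d′ + s ≤ k + n → d + s ≤ suc k + n
edge-budget {d} {d′} s k n d≤d′+1 budget =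
  ≤-trans (+-monoˡ-≤ s d≤d′+1) (subst (_≤ suc k + n) (cong (_+ s) (+-comm 1 d′)) (s≤s budget))

pullback : ∀ {n m} {G : Graph n} {H : Graph m} → Modification G H → ∀ Cs′ → Covers m Cs′ →
  Σ (List (Subset n)) λ Cs → Covers n Cs ×
    (∀ k → disagreements H Cs′ + totalSize Cs′ ≤ k + m → disagreements G Cs + totalSize Cs ≤ suc k + n)
pullback {n} {G = G} (edgeAddition u v u≢v uv∉G H H≡G+uv) Cs′ cov =
  Cs′ , cov , λ k → edge-budget (totalSize Cs′) k n
                      (disagreements-toggle-≤ G H (edgeAddition-toggles G H uv∉G H≡G+uv) u≢v Cs′)
pullback {n} {G = G} (edgeDeletion u v uv∈G H H≡G-uv) Cs′ cov =
  Cs′ , cov , λ k → edge-budget (totalSize Cs′) k n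
                      (disagreements-toggle-≤ G H (edgeDeletion-toggles G H uv∈G H≡G-uv) (adjacent⇒≢ G uv∈G) Cs′)
pullback {n} {G = G} (vertexSplit u H unchanged _ divided) Cs′ cov =
  Cs , covers cov , λ k budget →
    ≤-trans (+-mono-≤ disagreements-≤ totalSize-≤)
            (subst (disagreements H Cs′ + totalSize Cs′ ≤_) (+-suc k n) budget)
  where open SplitPullback {G = G} {H = H} unchanged divided Cs′

editing⇒cover : ∀ {n m j} {G : Graph n} {H : Graph m} → Modifications G H j → IsCluster H →
  Σ (List (Subset n)) λ Cs → Covers n Cs × disagreements G Cs + totalSize Cs ≤ j + n
editing⇒cover {G = G} done cluster = cluster-cover G cluster
editing⇒cover {j = suc j} (more modification rest) cluster with editing⇒cover rest cluster
... | Cs′ , cov′ , budget with pullback modification Cs′ cov′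
...   | Cs , cov , pulled = Cs , cov , pulled j budget

-- From a cover to a cluster editing sequence

Editable : ∀ {n} → Graph n → ℕ → Set
Editable G k = Σ ℕ λ m → Σ (Graph m) λ H → Σ ℕ λ j → j ≤ k × Modifications G H j × IsCluster H

prepend : ∀ {n m k} {G : Graph n} {H : Graph m} → Modification G H → Editable H k → Editable G (suc k)
prepend modification (m , K , j , j≤k , rest , cluster) =
  m , K , suc j , s≤s j≤k , more modification rest , cluster

togetherIn-trans : ∀ {n} (Cs : List (Subset n)) {u w v} → multiplicity w Cs ≤ 1 →
  togetherIn Cs u w ≡ true → togetherIn Cs w v ≡ true → togetherIn Cs u v ≡ true
togetherIn-trans {n} Cs {u} {w} {v} m≤1 uw∈Cs wv∈Cs =
  Any⇒any (λ C → lookup C u ∧ lookup C v)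
    (through Cs m≤1 (any⇒Any (λ C → lookup C u ∧ lookup C w) Cs uw∈Cs)
                    (any⇒Any (λ C → lookup C w ∧ lookup C v) Cs wv∈Cs))
  where
  twice : ∀ {C Cs} → lookup C w ≡ true → Any (λ D → lookup D w ≡ true) Cs → ¬ multiplicity w (C ∷ Cs) ≤ 1
  twice w∈C w∈Cs m≤1 rewrite w∈C with () ← ≤-trans (Any⇒multiplicity w∈Cs) (≤-pred m≤1)
  through : ∀ Cs → multiplicity w Cs ≤ 1 →
    Any (λ C → lookup C u ∧ lookup C w ≡ true) Cs → Any (λ C → lookup C w ∧ lookup C v ≡ true) Cs →
    Any (λ C → lookup C u ∧ lookup C v ≡ true) Cs
  through (C ∷ Cs) m≤1 (here uw∈C) (here wv∈C) =
    here (cong₂ _∧_ (proj₁ (∧-true _ _ uw∈C)) (proj₂ (∧-true (lookup C w) _ wv∈C)))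
  through (C ∷ Cs) m≤1 (here uw∈C) (there wv∈Cs) =
    ⊥-elim (twice {C} (proj₂ (∧-true (lookup C u) _ uw∈C))
                      (mapAny (λ {D} → proj₁ ∘ ∧-true (lookup D w) _) wv∈Cs) m≤1)
  through (C ∷ Cs) m≤1 (there uw∈Cs) (here wv∈C) =
    ⊥-elim (twice {C} (proj₁ (∧-true (lookup C w) _ wv∈C))
                      (mapAny (λ {D} → proj₂ ∘ ∧-true (lookup D u) _) uw∈Cs) m≤1)
  through (C ∷ Cs) m≤1 (there uw∈Cs) (there wv∈Cs) =
    there (through Cs (≤-trans (m≤n+m _ (𝟙 (lookup C w))) m≤1) uw∈Cs wv∈Cs)

agrees⇒cluster : ∀ {n} {G : Graph n} {Cs} → Agrees G Cs → (∀ x → multiplicity x Cs ≤ 1) → IsCluster G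
agrees⇒cluster {G = G} {Cs} agree single u v u≢v path with connected⇒together path
  where
  connected⇒together : ∀ {u v} → Connected G u v → u ≡ v ⊎ togetherIn Cs u v ≡ true
  connected⇒together here = inj₁ refl
  connected⇒together (step {u} {w} uw∈G rest) with connected⇒together rest
  ... | inj₁ refl = inj₂ (trans (sym (agree u w (adjacent⇒≢ G uw∈G))) uw∈G)
  ... | inj₂ wv∈Cs =
    inj₂ (togetherIn-trans Cs (single w) (trans (sym (agree u w (adjacent⇒≢ G uw∈G))) uw∈G) wv∈Cs)
... | inj₁ u≡v   = ⊥-elim (u≢v u≡v)
... | inj₂ uv∈Cs = trans (agree u v u≢v) uv∈Cs

shared-split : ∀ {n} (u : Fin n) (Cs : List (Subset n)) → 2 ≤ multiplicity u Cs →
  Σ (List (Subset n)) λ Front → Σ (List (Subset n)) λ Rest → Cs ≡ Front ++ Rest ×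
    Any (λ C → lookup C u ≡ true) Front × Any (λ C → lookup C u ≡ true) Rest
shared-split u (C ∷ Cs) 2≤m with lookup C u in u∈C
... | true  = C ∷ [] , Cs , refl , here u∈C , multiplicity⇒Any u Cs (≤-pred 2≤m)
... | false with shared-split u Cs 2≤m
...   | Front , Rest , refl , u∈Front , u∈Rest = C ∷ Front , Rest , refl , there u∈Front , u∈Rest

-- u is split into inject₁ u, which stays in the members of Front,
-- and fromℕ n, which replaces u in the members of Rest
module SharedSplit {n} (G : Graph n) (u : Fin n) (Front Rest : List (Subset n))
                   (agree : Agrees G (Front ++ Rest)) where

  keep : Subset n → Subset (suc n)
  keep C = C ∷ʳ false

  move : Subset n → Subset (suc n)
  move C = (C [ u ]≔ false) ∷ʳ lookup C u

  Cs′ : List (Subset (suc n))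
  Cs′ = map keep Front ++ map move Rest

  H : Graph (suc n)
  H = coverGraph Cs′

  private
    keep-old : ∀ C x → lookup (keep C) (inject₁ x) ≡ lookup C x
    keep-old C = lookup-∷ʳ-inject₁ C false

    keep-new : ∀ C → lookup (keep C) (fromℕ n) ≡ false
    keep-new C = lookup-∷ʳ-fromℕ C false

    move-old : ∀ C {x} → x ≢ u → lookup (move C) (inject₁ x) ≡ lookup C x
    move-old C {x} x≢u =
      trans (lookup-∷ʳ-inject₁ (C [ u ]≔ false) (lookup C u) x) (lookup∘update′ x≢u C false)

    move-new : ∀ C → lookup (move C) (fromℕ n) ≡ lookup C u
    move-new C = lookup-∷ʳ-fromℕ (C [ u ]≔ false) (lookup C u)

    move-at : ∀ C → lookup (move C) (inject₁ u) ≡ false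
    move-at C = trans (lookup-∷ʳ-inject₁ (C [ u ]≔ false) (lookup C u) u) (lookup∘updateAt u C)

    together′ : Fin (suc n) → Fin (suc n) → Subset (suc n) → Bool
    together′ i j C = lookup C i ∧ lookup C j

    togetherIn′ : ∀ i j → togetherIn Cs′ i j ≡
      any (together′ i j ∘ keep) Front ∨ any (together′ i j ∘ move) Rest
    togetherIn′ i j = trans (any-++ (together′ i j) (map keep Front) (map move Rest))
      (cong₂ _∨_ (any-map (together′ i j) keep Front) (any-map (together′ i j) move Rest))

    together-old : ∀ {x y} → x ≢ u → y ≢ u →
      togetherIn Cs′ (inject₁ x) (inject₁ y) ≡ togetherIn (Front ++ Rest) x y
    together-old {x} {y} x≢u y≢u = begin
      togetherIn Cs′ (inject₁ x) (inject₁ y)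
        ≡⟨ togetherIn′ (inject₁ x) (inject₁ y) ⟩
      any (together′ (inject₁ x) (inject₁ y) ∘ keep) Front ∨ any (together′ (inject₁ x) (inject₁ y) ∘ move) Rest
        ≡⟨ cong₂ _∨_ (any-cong Front λ C → cong₂ _∧_ (keep-old C x) (keep-old C y))
                     (any-cong Rest λ C → cong₂ _∧_ (move-old C x≢u) (move-old C y≢u)) ⟩
      togetherIn Front x y ∨ togetherIn Rest x y
        ≡⟨ any-++ (λ C → lookup C x ∧ lookup C y) Front Rest ⟨
      togetherIn (Front ++ Rest) x y ∎
      where open ≡-Reasoning

    together-v : ∀ {x} → x ≢ u → togetherIn Cs′ (inject₁ u) (inject₁ x) ≡ togetherIn Front u x
    together-v {x} x≢u = begin
      togetherIn Cs′ (inject₁ u) (inject₁ x)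
        ≡⟨ togetherIn′ (inject₁ u) (inject₁ x) ⟩
      any (together′ (inject₁ u) (inject₁ x) ∘ keep) Front ∨ any (together′ (inject₁ u) (inject₁ x) ∘ move) Rest
        ≡⟨ cong₂ _∨_ (any-cong Front λ C → cong₂ _∧_ (keep-old C u) (keep-old C x))
                     (any-false (together′ (inject₁ u) (inject₁ x) ∘ move) Rest λ C →
                       cong (_∧ lookup (move C) (inject₁ x)) (move-at C)) ⟩
      togetherIn Front u x ∨ false
        ≡⟨ ∨-identityʳ _ ⟩
      togetherIn Front u x ∎
      where open ≡-Reasoning

    together-w : ∀ {x} → x ≢ u → togetherIn Cs′ (fromℕ n) (inject₁ x) ≡ togetherIn Rest u x
    together-w {x} x≢u = begin
      togetherIn Cs′ (fromℕ n) (inject₁ x)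
        ≡⟨ togetherIn′ (fromℕ n) (inject₁ x) ⟩
      any (together′ (fromℕ n) (inject₁ x) ∘ keep) Front ∨ any (together′ (fromℕ n) (inject₁ x) ∘ move) Rest
        ≡⟨ cong₂ _∨_ (any-false (together′ (fromℕ n) (inject₁ x) ∘ keep) Front λ C →
                       cong (_∧ lookup (keep C) (inject₁ x)) (keep-new C))
                     (any-cong Rest λ C → cong₂ _∧_ (move-new C) (move-old C x≢u)) ⟩
      togetherIn Rest u x ∎
      where open ≡-Reasoning

    together-vw : togetherIn Cs′ (inject₁ u) (fromℕ n) ≡ false
    together-vw = trans (togetherIn′ (inject₁ u) (fromℕ n)) (cong₂ _∨_
      (any-false (together′ (inject₁ u) (fromℕ n) ∘ keep) Front λ C →
         trans (cong (lookup (keep C) (inject₁ u) ∧_) (keep-new C)) (∧-zeroʳ _))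
      (any-false (together′ (inject₁ u) (fromℕ n) ∘ move) Rest λ C →
         cong (_∧ lookup (move C) (fromℕ n)) (move-at C)))

    unchanged : ∀ x y → x ≢ u → y ≢ u → adj H (inject₁ x) (inject₁ y) ≡ adj G x y
    unchanged x y x≢u y≢u with x ≟ y
    ... | yes refl = trans (irrefl H (inject₁ x)) (sym (irrefl G x))
    ... | no x≢y   = trans (coverGraph-agrees Cs′ _ _ (x≢y ∘ inject₁-injective))
                           (trans (together-old x≢u y≢u) (sym (agree x y x≢y)))

    separated : adj H (inject₁ u) (fromℕ n) ≡ false
    separated = cong (λ t → t ∧ not ⌊ inject₁ u ≟ fromℕ n ⌋) together-vw

    divided : ∀ x → x ≢ u → adj G u x ≡ (adj H (inject₁ u) (inject₁ x) ∨ adj H (fromℕ n) (inject₁ x))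
    divided x x≢u = begin
      adj G u x                                     ≡⟨ agree u x (x≢u ∘ sym) ⟩
      togetherIn (Front ++ Rest) u x                ≡⟨ any-++ (λ C → lookup C u ∧ lookup C x) Front Rest ⟩
      togetherIn Front u x ∨ togetherIn Rest u x    ≡⟨ cong₂ _∨_ (together-v x≢u) (together-w x≢u) ⟨
      togetherIn Cs′ (inject₁ u) (inject₁ x) ∨ togetherIn Cs′ (fromℕ n) (inject₁ x)
        ≡⟨ cong₂ _∨_ (coverGraph-agrees Cs′ _ _ (x≢u ∘ sym ∘ inject₁-injective))
                     (coverGraph-agrees Cs′ _ _ fromℕ≢inject₁) ⟨
      adj H (inject₁ u) (inject₁ x) ∨ adj H (fromℕ n) (inject₁ x) ∎
      where open ≡-Reasoning

  modification : Modification G H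
  modification = vertexSplit u H unchanged separated divided

  disagreements-H : disagreements H Cs′ ≡ 0
  disagreements-H = disagreements-agree {G = H} {Cs′} (coverGraph-agrees Cs′)

  totalSize-Cs′ : totalSize Cs′ ≡ totalSize (Front ++ Rest)
  totalSize-Cs′ = begin
    totalSize Cs′                                         ≡⟨ totalSize-++ (map keep Front) (map move Rest) ⟩
    totalSize (map keep Front) + totalSize (map move Rest)
      ≡⟨ cong₂ _+_ (totalSize-map-≡ keep Front ∣keep∣) (totalSize-map-≡ move Rest ∣move∣) ⟩
    totalSize Front + totalSize Rest                      ≡⟨ totalSize-++ Front Rest ⟨
    totalSize (Front ++ Rest)                             ∎
    where
    open ≡-Reasoning
    ∣keep∣ : ∀ C → ∣ keep C ∣ ≡ ∣ C ∣
    ∣keep∣ C = trans (∣∷ʳ∣ C false) (+-identityʳ _)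
    ∣move∣ : ∀ C → ∣ move C ∣ ≡ ∣ C ∣
    ∣move∣ C = trans (∣∷ʳ∣ (C [ u ]≔ false) (lookup C u))
                     (trans (∣updateAt∣ C u (λ _ → false)) (+-identityʳ _))

  covers : Covers n (Front ++ Rest) →
    Any (λ C → lookup C u ≡ true) Front → Any (λ C → lookup C u ≡ true) Rest → Covers (suc n) Cs′
  covers cov u∈Front u∈Rest i with injectOrLast i
  ... | lastVertex  = Anyₚ.++⁺ʳ (map keep Front) (Anyₚ.gmap (λ {C} u∈C → trans (move-new C) u∈C) u∈Rest)
  ... | oldVertex x with x ≟ u
  ...   | yes refl = Anyₚ.++⁺ˡ (Anyₚ.gmap (λ {C} u∈C → trans (keep-old C u) u∈C) u∈Front)
  ...   | no x≢u with Anyₚ.++⁻ Front (cov x)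
  ...     | inj₁ x∈Front = Anyₚ.++⁺ˡ (Anyₚ.gmap (λ {C} x∈C → trans (keep-old C x) x∈C) x∈Front)
  ...     | inj₂ x∈Rest  = Anyₚ.++⁺ʳ (map keep Front) (Anyₚ.gmap (λ {C} x∈C → trans (move-old C x≢u) x∈C) x∈Rest)

data Defect {n} (G : Graph n) (Cs : List (Subset n)) : Set where
  wrongPair    : ∀ u v → u ≢ v → adj G u v xor togetherIn Cs u v ≡ true → Defect G Cs
  sharedVertex : Agrees G Cs → ∀ u → 2 ≤ multiplicity u Cs → Defect G Cs
  noDefect     : Agrees G Cs → (∀ x → multiplicity x Cs ≤ 1) → Defect G Cs

WrongPair : ∀ {n} → Graph n → List (Subset n) → Set
WrongPair G Cs = ∃ λ u → ∃ λ v → u ≢ v × adj G u v xor togetherIn Cs u v ≡ true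

no-wrongPair⇒agrees : ∀ {n} {G : Graph n} {Cs} → ¬ WrongPair G Cs → Agrees G Cs
no-wrongPair⇒agrees {G = G} {Cs} no-wrong x y x≢y =
  xor≢true⇒≡ (adj G x y) (togetherIn Cs x y) λ wrong → no-wrong (x , y , x≢y , wrong)
  where
  xor≢true⇒≡ : ∀ a t → a xor t ≢ true → a ≡ t
  xor≢true⇒≡ true  true  _     = refl
  xor≢true⇒≡ true  false wrong = ⊥-elim (wrong refl)
  xor≢true⇒≡ false true  wrong = ⊥-elim (wrong refl)
  xor≢true⇒≡ false false _     = refl

defect : ∀ {n} (G : Graph n) (Cs : List (Subset n)) → Defect G Cs
defect G Cs with any? (λ u → any? (λ v → ¬? (u ≟ v) ×-dec (adj G u v xor togetherIn Cs u v Bool.≟ true)))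
... | yes (u , v , u≢v , wrong) = wrongPair u v u≢v wrong
... | no no-wrong with any? (λ u → 2 ≤? multiplicity u Cs)
...   | yes (u , 2≤m) = sharedVertex (no-wrongPair⇒agrees {G = G} {Cs} no-wrong) u 2≤m
...   | no no-shared  =
  noDefect (no-wrongPair⇒agrees {G = G} {Cs} no-wrong) λ x → ≤-pred (≰⇒> λ 2≤m → no-shared (x , 2≤m))

budget-0 : ∀ {d s n} → n ≤ s → d + s ≤ 0 + n → d ≡ 0
budget-0 {d} {s} n≤s budget = n≤0⇒n≡0 (+-cancelʳ-≤ s d 0 (≤-trans budget n≤s))

cover⇒editing : ∀ k {n} (G : Graph n) (Cs : List (Subset n)) → Covers n Cs →
  disagreements G Cs + totalSize Cs ≤ k + n → Editable G k
cover⇒editing k G Cs cov budget with defect G Cs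
... | noDefect agree single = _ , G , 0 , z≤n , done , agrees⇒cluster {Cs = Cs} agree single
cover⇒editing zero G Cs cov budget | wrongPair u v u≢v wrong
  with () ← trans (+-comm 1 _)
                  (trans (sym (disagreements-toggle G (toggle G u v u≢v) (toggle-toggles G u≢v) u≢v Cs wrong))
                         (budget-0 (totalSize-cover cov) budget))
cover⇒editing (suc k) {n} G Cs cov budget | wrongPair u v u≢v wrong =
  prepend (toggle-modification G u v u≢v) (cover⇒editing k H Cs cov (≤-pred (begin
    suc (disagreements H Cs + totalSize Cs)   ≡⟨ cong (_+ totalSize Cs) (+-comm 1 (disagreements H Cs)) ⟩
    disagreements H Cs + 1 + totalSize Cs
      ≡⟨ cong (_+ totalSize Cs) (disagreements-toggle G H (toggle-toggles G u≢v) u≢v Cs wrong) ⟨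
    disagreements G Cs + totalSize Cs         ≤⟨ budget ⟩
    suc k + n                                 ∎)))
  where
  open ≤-Reasoning
  H : Graph n
  H = toggle G u v u≢v
cover⇒editing zero {n} G Cs cov budget | sharedVertex agree u 2≤m =
  ⊥-elim (<-irrefl refl (≤-trans (totalSize-cover-shared cov u 2≤m) (≤-trans (m≤n+m _ _) budget)))
cover⇒editing (suc k) {n} G Cs cov budget | sharedVertex agree u 2≤m with shared-split u Cs 2≤m
... | Front , Rest , refl , u∈Front , u∈Rest =
  prepend modification (cover⇒editing k H Cs′ (covers cov u∈Front u∈Rest) (begin
    disagreements H Cs′ + totalSize Cs′
      ≡⟨ cong₂ _+_ (trans disagreements-H (sym (disagreements-agree {G = G} {Cs} agree))) totalSize-Cs′ ⟩
    disagreements G Cs + totalSize Cs     ≤⟨ budget ⟩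
    suc k + n                             ≡⟨ +-suc k n ⟨
    k + suc n                             ∎))
  where
  open ≤-Reasoning
  open SharedSplit G u Front Rest agree

unique-cover : ∀ {n} (G : Graph n) {Cs k} → Covers n Cs → disagreements G Cs + totalSize Cs ≤ k + n →
  Σ (List (Subset n)) λ Ds → IsCover n Ds × disagreements G Ds + totalSize Ds ≤ k + n
unique-cover G {Cs} cov budget =
  dedup Cs , (deduplicate-! _≟ˢ_ Cs , Any-dedup⁺ ∘ cov) ,
  ≤-trans (+-mono-≤ (≤-reflexive (disagreements-dedup G Cs)) (totalSize-dedup Cs)) budget

lemma9 : ∀ {n} (G : Graph n) (k : ℕ) → 1 ≤ k →
    (Σ ℕ λ m → Σ (Graph m) λ H → Σ ℕ λ j → j ≤ k × Modifications G H j × IsCluster H)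
    ⇔ (Σ (List (Subset n)) λ Cs → IsCover n Cs × cost G Cs ≤ k)
lemma9 {n} G k _ = mk⇔ editing⇒cover′ cover⇒editing′
  where
  editing⇒cover′ : Editable G k → Σ (List (Subset n)) λ Cs → IsCover n Cs × cost G Cs ≤ k
  editing⇒cover′ (_ , _ , j , j≤k , edits , cluster) with editing⇒cover edits cluster
  ... | Cs , cov , budget with unique-cover G cov (≤-trans budget (+-monoˡ-≤ n j≤k))
  ...   | Ds , isCover , budget′ = Ds , isCover , Equivalence.from (cost≤⇔ G Ds k) budget′
  cover⇒editing′ : (Σ (List (Subset n)) λ Cs → IsCover n Cs × cost G Cs ≤ k) → Editable G k
  cover⇒editing′ (Cs , (_ , cov) , cost≤k) = cover⇒editing k G Cs cov (Equivalence.to (cost≤⇔ G Cs k) cost≤k)
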